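{- Let $A$ be a finite nonempty alphabet and let $S\subset A^*$ be an acyclic set. For every $w\in S$, every finite suffix code $U$ and every finite prefix code $V$, the generalized extension graph $E_{U,V}(w)$ is acyclic.
   Context: $S$ is factorial if it contains all factors of its elements. For $w\in S$: $L(w)=\{a\in A\mid aw\in S\}$, $R(w)=\{a\in A\mid wa\in S\}$, $E(w)=\{(a,b)\mid awb\in S\}$; $S$ is biextendable if factorial and $E(w)\neq\emptyset$ for all $w$. The extension graph of $w$ is the undirected bipartite graph with vertex set the disjoint union of $L(w)$ and $R(w)$ and an edge $a$–$b$ for each $(a,b)\in E(w)$; $S$ is acyclic if biextendable and all extension graphs are acyclic. A prefix code (resp. suffix code) is a set of nonempty words containing no proper prefix (resp. proper suffix) of any of its elements. For $w\in S$ and sets of words $U,V$, let $U(w)=\{\ell\in U\mid \ell w\in S\}$ and $V(w)=\{r\in V\mid wr\in S\}$; the generalized extension graph $E_{U,V}(w)$ is the undirected graph whose vertex set is the disjoint union of a copy of $U(w)$ and a copy of $V(w)$, with an edge $(\ell,r)$ for $\ell\in U(w)$, $r\in V(w)$ whenever $\ell wr\in S$. -}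

module Defs where

open import Data.Nat using (ℕ; suc; _≤_)
open import Data.Fin using (Fin)
open import Data.List using (List; []; _∷_; _++_; [_]; length)
open import Data.List.Membership.Propositional using (_∈_)
open import Data.List.Relation.Unary.All using (All)
open import Data.List.Relation.Unary.Unique.Propositional using (Unique)
open import Data.Product using (Σ; ∃; _×_; _,_)
open import Data.Sum using (_⊎_; inj₁; inj₂)
open import Data.Empty using (⊥)
open import Data.Unit using (⊤)
open import Relation.Nullary using (¬_)
open import Relation.Binary.PropositionalEquality using (_≡_)

record Graph (X : Set) : Set₁ where
  field
    Vert : X → Set
    Edge : X → X → Set      -- adjacency (symmetric by construction below)

Walk : {X : Set} → (X → X → Set) → List X → Set
Walk E []            = ⊤
Walk E (x ∷ [])      = ⊤
Walk E (x ∷ y ∷ xs)  = E x y × Walk E (y ∷ xs)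

Cycle : {X : Set} → Graph X → Set
Cycle {X} G = Σ X λ v → Σ (List X) λ vs →
    (2 ≤ length vs)
  × Unique (v ∷ vs)
  × All (Graph.Vert G) (v ∷ vs)
  × Walk (Graph.Edge G) (v ∷ vs ++ [ v ])

Acyclic : {X : Set} → Graph X → Set
Acyclic G = ¬ Cycle G

module Words (A : Set) where

  Word : Set
  Word = List A

  Factorial : (Word → Set) → Set
  Factorial S = ∀ u v x → S (u ++ v ++ x) → S v

  Ext : (Word → Set) → Word → A → A → Set
  Ext S w a b = S (a ∷ w ++ [ b ])

  Biextendable : (Word → Set) → Set
  Biextendable S = Factorial S × (∀ w → S w → Σ A λ a → Σ A λ b → Ext S w a b)

  -- extension graph of w: vertices L(w) ⊔ R(w) (left copy inj₁, right copy inj₂),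
  -- edge a – b for each (a,b) ∈ E(w)
  extGraph : (Word → Set) → Word → Graph (A ⊎ A)
  Graph.Vert (extGraph S w) (inj₁ a) = S (a ∷ w)
  Graph.Vert (extGraph S w) (inj₂ b) = S (w ++ [ b ])
  Graph.Edge (extGraph S w) (inj₁ a) (inj₂ b) = Ext S w a b
  Graph.Edge (extGraph S w) (inj₂ b) (inj₁ a) = Ext S w a b
  Graph.Edge (extGraph S w) (inj₁ _) (inj₁ _) = ⊥
  Graph.Edge (extGraph S w) (inj₂ _) (inj₂ _) = ⊥

  AcyclicSet : (Word → Set) → Set
  AcyclicSet S = Biextendable S × (∀ w → S w → Acyclic (extGraph S w))

  ProperPrefix : Word → Word → Set
  ProperPrefix x y = Σ A λ a → Σ Word λ z → y ≡ x ++ (a ∷ z)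

  ProperSuffix : Word → Word → Set
  ProperSuffix x y = Σ A λ a → Σ Word λ z → y ≡ (a ∷ z) ++ x

  -- finite sets of words are given as lists (membership _∈_)
  PrefixCode : List Word → Set
  PrefixCode U = (∀ x → x ∈ U → ¬ (x ≡ []))
               × (∀ x y → x ∈ U → y ∈ U → ¬ ProperPrefix x y)

  SuffixCode : List Word → Set
  SuffixCode U = (∀ x → x ∈ U → ¬ (x ≡ []))
               × (∀ x y → x ∈ U → y ∈ U → ¬ ProperSuffix x y)

  genExtGraph : (Word → Set) → List Word → List Word → Word → Graph (Word ⊎ Word)
  Graph.Vert (genExtGraph S U V w) (inj₁ l) = (l ∈ U) × S (l ++ w)
  Graph.Vert (genExtGraph S U V w) (inj₂ r) = (r ∈ V) × S (w ++ r)
  Graph.Edge (genExtGraph S U V w) (inj₁ l) (inj₂ r) =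
    (l ∈ U) × (r ∈ V) × S (l ++ w ++ r)
  Graph.Edge (genExtGraph S U V w) (inj₂ r) (inj₁ l) =
    (l ∈ U) × (r ∈ V) × S (l ++ w ++ r)
  Graph.Edge (genExtGraph S U V w) (inj₁ _) (inj₁ _) = ⊥
  Graph.Edge (genExtGraph S U V w) (inj₂ _) (inj₂ _) = ⊥

-- Given a cycle of E_{U,V}(w), we construct a cycle of an ordinary extension graph E(w′), which
-- contradicts acyclicity of S. The induction is on the total length of the labels of the cycle,
-- and only uses that the labels on each side are pairwise prefix-free (right) and suffix-free
-- (left). If every label is a letter, the cycle is already a cycle of E(w). Otherwise some label
-- has length at least two; reversing all words if necessary, it is a right label a b u. If every
-- right label begins with a, deleting this a gives a cycle for the word w a. Otherwise take an arc
-- of the cycle that leaves and re-enters the right labels beginning with a at vertices p and y and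
-- meets a right label not beginning with a in between: by factoriality p and y may both be replaced
-- by the single vertex a, and this shortens the cycle because y ≠ a, as a is a proper prefix of a b u.
module Submission where

open import Data.Empty using (⊥; ⊥-elim)
open import Data.Fin as Fin using (Fin)
open import Data.List
  using (List; []; _∷_; _++_; [_]; _∷ʳ_; length; map; reverse; drop; head)
open import Data.List.Membership.Propositional using (_∈_; _∉_; find)
open import Data.List.Membership.Propositional.Properties
  using (∈-∃++; ∈-++⁺ˡ; ∈-++⁺ʳ; ∈-map⁺)
open import Data.List.Properties
  using (++-assoc; ++-identityʳ; ∷ʳ-++; map-++; length-map; length-reverse;
         reverse-++; reverse-involutive; reverse-injective)
open import Data.List.Relation.Binary.Permutation.Propositional using (_↭_; ↭-sym; ↭⇒↭ₛ)
open import Data.List.Relation.Binary.Permutation.Propositional.Properties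
  using (++-comm; ∷↭∷ʳ; ∈-resp-↭; ↭-length)
import Data.List.Relation.Binary.Permutation.Propositional.Properties as ↭
import Data.List.Relation.Binary.Permutation.Setoid.Properties as ↭ₛ
open import Data.List.Relation.Binary.Subset.Propositional using (_⊆_)
open import Data.List.Relation.Unary.All as All using (All; []; _∷_)
import Data.List.Relation.Unary.All.Properties as All
open import Data.List.Relation.Unary.AllPairs using ([]; _∷_)
open import Data.List.Relation.Unary.Any as Any using (Any; here; there)
import Data.List.Relation.Unary.Any.Properties as Any
import Data.List.Relation.Unary.First as First
import Data.List.Relation.Unary.First.Properties as First
open import Data.List.Relation.Unary.Unique.Propositional using (Unique)
import Data.List.Relation.Unary.Unique.Propositional.Properties as Unique
open import Data.Maybe using (fromMaybe)
open import Data.Nat using (ℕ; suc; _+_; _≤_; _<_; _≤?_; s≤s; z≤n)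
open import Data.Nat.Induction using (<-wellFounded)
open import Data.Nat.ListAction using (sum)
open import Data.Nat.ListAction.Properties using (sum-++; sum-↭)
open import Data.Nat.Properties
  using (≤-refl; ≤-pred; n≤1+n; n<1+n; m≤m+n; +-comm; +-monoˡ-≤; +-mono-≤;
         +-mono-<-≤; +-mono-≤-<;
         module ≤-Reasoning)
open import Data.Product using (Σ; ∃; _×_; _,_; proj₁; proj₂)
open import Data.Sum as Sum using (_⊎_; inj₁; inj₂)
open import Data.Sum.Properties using (inj₁-injective; inj₂-injective)
open import Data.Unit using (⊤; tt)
open import Function using (_∘_; id)
open import Induction.WellFounded using (Acc; acc)
open import Relation.Binary.Definitions using (DecidableEquality)
open import Relation.Binary.PropositionalEquality
  using (_≡_; _≢_; refl; sym; trans; cong; cong₂; subst; subst₂; setoid; module ≡-Reasoning)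
open import Relation.Nullary using (¬_; yes; no)
import Relation.Nullary.Decidable as Dec
open import Relation.Unary using (Decidable; ∁)

open import Defs

Closed : {X : Set} → (X → X → Set) → List X → Set
Closed R []       = ⊤
Closed R (x ∷ xs) = Walk R (x ∷ xs ++ [ x ])

module _ {X : Set} {R : X → X → Set} where

  walk-∷ʳ : ∀ xs {x y} → Walk R (xs ++ [ x ]) → R x y → Walk R ((xs ++ [ x ]) ++ [ y ])
  walk-∷ʳ []            _          r = r , tt
  walk-∷ʳ (z ∷ [])      (r₁ , _)   r = r₁ , r , tt
  walk-∷ʳ (z ∷ z′ ∷ zs) (r₁ , wlk) r = r₁ , walk-∷ʳ (z′ ∷ zs) wlk r

  walk-++⁻ˡ : ∀ xs {ys} → Walk R (xs ++ ys) → Walk R xs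
  walk-++⁻ˡ []            _         = tt
  walk-++⁻ˡ (x ∷ [])      _         = tt
  walk-++⁻ˡ (x ∷ x′ ∷ xs) (r , wlk) = r , walk-++⁻ˡ (x′ ∷ xs) wlk

  walk-successors : ∀ xs {y} → Walk R (xs ++ [ y ]) → All (λ x → ∃ (R x)) xs
  walk-successors []            _         = []
  walk-successors (x ∷ [])      (r , _)   = (_ , r) ∷ []
  walk-successors (x ∷ x′ ∷ xs) (r , wlk) = (_ , r) ∷ walk-successors (x′ ∷ xs) wlk

  walk-replace-last : ∀ xs {y y′} → (∀ {x} → R x y → R x y′) →
                      Walk R (xs ++ [ y ]) → Walk R (xs ++ [ y′ ])
  walk-replace-last []            _ _         = tt
  walk-replace-last (x ∷ [])      f (r , _)   = f r , tt
  walk-replace-last (x ∷ x′ ∷ xs) f (r , wlk) = r , walk-replace-last (x′ ∷ xs) f wlk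

  walk-replace-ends : ∀ xs {x y c} → (∀ {z} → R x z → R c z) → (∀ {z} → R z y → R z c) →
                      Walk R (x ∷ xs ++ [ y ]) → Walk R (c ∷ xs ++ [ c ])
  walk-replace-ends []       f g (r , _)   = g (f r) , tt
  walk-replace-ends (z ∷ zs) f g (r , wlk) = f r , walk-replace-last (z ∷ zs) g wlk

  walk-weaken : ∀ {R′ : X → X → Set} → (∀ {x y} → R x y → R′ x y) →
                ∀ {xs} → Walk R xs → Walk R′ xs
  walk-weaken f {[]}         _         = tt
  walk-weaken f {x ∷ []}     _         = tt
  walk-weaken f {x ∷ y ∷ xs} (r , wlk) = f r , walk-weaken f wlk

  closed-rotate₁ : ∀ x xs → Closed R (x ∷ xs) → Closed R (xs ++ [ x ])
  closed-rotate₁ x []       c         = c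
  closed-rotate₁ x (y ∷ ys) (r , wlk) = walk-∷ʳ (y ∷ ys) wlk r

  closed-rotate : ∀ xs ys → Closed R (xs ++ ys) → Closed R (ys ++ xs)
  closed-rotate []       ys c = subst (Closed R) (sym (++-identityʳ ys)) c
  closed-rotate (x ∷ xs) ys c =
    subst (Closed R) (++-assoc ys [ x ] xs)
      (closed-rotate xs (ys ++ [ x ])
        (subst (Closed R) (++-assoc xs ys [ x ]) (closed-rotate₁ x (xs ++ ys) c)))

module _ {X Y : Set} {R : X → X → Set} {R′ : Y → Y → Set} {Q : X → Set} (f : X → Y)
         (f-adjacent : ∀ {x y} → Q x → Q y → R x y → R′ (f x) (f y)) where

  walk-map : ∀ {xs} → All Q xs → Walk R xs → Walk R′ (map f xs)
  walk-map {[]}         _              _         = tt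
  walk-map {x ∷ []}     _              _         = tt
  walk-map {x ∷ y ∷ xs} (qx ∷ qy ∷ qs) (r , wlk) = f-adjacent qx qy r , walk-map (qy ∷ qs) wlk

  closed-map : ∀ {xs} → All Q xs → Closed R xs → Closed R′ (map f xs)
  closed-map {[]}     _         _ = tt
  closed-map {x ∷ xs} (qx ∷ qs) c =
    subst (λ ys → Walk R′ (f x ∷ ys)) (map-++ f xs [ x ])
      (walk-map (qx ∷ All.++⁺ qs (qx ∷ [])) c)

Unique-++⁻ˡ : ∀ {X : Set} (xs : List X) {ys} → Unique (xs ++ ys) → Unique xs
Unique-++⁻ˡ []       _          = []
Unique-++⁻ˡ (x ∷ xs) (x∉ ∷ uni) = All.++⁻ˡ xs x∉ ∷ Unique-++⁻ˡ xs uni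

Unique-map⁺-on : ∀ {X Y : Set} {Q : X → Set} (f : X → Y) →
                 (∀ {x y} → Q x → Q y → f x ≡ f y → x ≡ y) →
                 ∀ {xs} → All Q xs → Unique xs → Unique (map f xs)
Unique-map⁺-on f f-injective {[]}     []        []         = []
Unique-map⁺-on f f-injective {x ∷ xs} (qx ∷ qs) (x∉ ∷ uni) =
  distinct qs x∉ ∷ Unique-map⁺-on f f-injective qs uni
  where
  distinct : ∀ {ys} → All _ ys → All (x ≢_) ys → All (f x ≢_) (map f ys)
  distinct []          []           = []
  distinct (qy ∷ qys) (x≢y ∷ x∉ys) = (x≢y ∘ f-injective qx qy) ∷ distinct qys x∉ys

module _ {X : Set} {Q : X → Set} (Q? : Decidable Q) where

  first-occurrence : ∀ {xs} → Any Q xs →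
    Σ (List X) λ ys → Σ X λ y → Σ (List X) λ zs → xs ≡ ys ++ y ∷ zs × All (∁ Q) ys × Q y
  first-occurrence q with First.toView (First.refine (λ {x} _ → Dec.toSum (Q? x)) (First.fromAny q))
  ... | ¬qs First.++ qy ∷ zs = _ , _ , zs , refl , ¬qs , qy

  last-occurrence : ∀ {xs} → Any Q xs →
    Σ (List X) λ ys → Σ X λ y → Σ (List X) λ zs → xs ≡ ys ++ y ∷ zs × Q y × All (∁ Q) zs
  last-occurrence {x ∷ xs} q with Any.any? Q? xs
  ... | yes q′ with last-occurrence q′
  ...   | ys , y , zs , refl , qy , ¬qs = x ∷ ys , y , zs , refl , qy , ¬qs
  last-occurrence {x ∷ xs} (here qx) | no ¬q = [] , x , xs , refl , qx , All.¬Any⇒All¬ xs ¬q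
  last-occurrence {x ∷ xs} (there q) | no ¬q = ⊥-elim (¬q q)

module CodeCycles (A : Set) (_≟_ : DecidableEquality A) where
  open Words A

  Vertex : Set
  Vertex = Word ⊎ Word

  label : Vertex → Word
  label (inj₁ l) = l
  label (inj₂ r) = r

  data Adjacent (S : Word → Set) (w : Word) : Vertex → Vertex → Set where
    left-right : ∀ {l r} → S (l ++ w ++ r) → Adjacent S w (inj₁ l) (inj₂ r)
    right-left : ∀ {l r} → S (l ++ w ++ r) → Adjacent S w (inj₂ r) (inj₁ l)

  weight : List Vertex → ℕ
  weight xs = sum (map (length ∘ label) xs)

  Long : Vertex → Set
  Long v = 2 ≤ length (label v)

  long? : Decidable Long
  long? v = 2 ≤? length (label v)

  record Coded (xs : List Vertex) : Set where
    field
      nonempty    : ∀ {v} → v ∈ xs → label v ≢ []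
      prefix-free : ∀ {r r′} → inj₂ r ∈ xs → inj₂ r′ ∈ xs → ¬ ProperPrefix r r′
      suffix-free : ∀ {l l′} → inj₁ l ∈ xs → inj₁ l′ ∈ xs → ¬ ProperSuffix l l′

  -- A cycle of E_{U,V}(w) with U and V forgotten: only the code conditions among its own
  -- labels are kept, which is what survives the reductions below.
  record CodeCycle (S : Word → Set) (w : Word) (xs : List Vertex) : Set where
    field
      length≥3 : 3 ≤ length xs
      unique   : Unique xs
      closed   : Closed (Adjacent S w) xs
      coded    : Coded xs

  CodeCycleBelow : (Word → Set) → ℕ → Set
  CodeCycleBelow S n = Σ Word λ w → Σ (List Vertex) λ xs → CodeCycle S w xs × weight xs < n

  private
    variable
      S S′            : Word → Set
      w l r u         : Word
      a b             : A
      p n y v v′      : Vertex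
      xs ys zs T more : List Vertex

  weight-++ : ∀ xs ys → weight (xs ++ ys) ≡ weight xs + weight ys
  weight-++ xs ys =
    trans (cong sum (map-++ (length ∘ label) xs ys)) (sum-++ (map (length ∘ label) xs) _)

  weight-↭ : xs ↭ ys → weight xs ≡ weight ys
  weight-↭ xs↭ys = sum-↭ (↭.map⁺ (length ∘ label) xs↭ys)

  coded-⊆ : ys ⊆ xs → Coded xs → Coded ys
  coded-⊆ ys⊆xs coded = record
    { nonempty    = λ v∈ → nonempty (ys⊆xs v∈)
    ; prefix-free = λ r∈ r′∈ → prefix-free (ys⊆xs r∈) (ys⊆xs r′∈)
    ; suffix-free = λ l∈ l′∈ → suffix-free (ys⊆xs l∈) (ys⊆xs l′∈) }
    where open Coded coded

  cycle-rotate : ∀ xs ys → CodeCycle S w (xs ++ ys) → CodeCycle S w (ys ++ xs)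
  cycle-rotate xs ys c = record
    { length≥3 = subst (3 ≤_) (↭-length (++-comm xs ys)) length≥3
    ; unique   = ↭ₛ.Unique-resp-↭ (setoid Vertex) (↭⇒↭ₛ (++-comm xs ys)) unique
    ; closed   = closed-rotate xs ys closed
    ; coded    = coded-⊆ (∈-resp-↭ (++-comm ys xs)) coded }
    where open CodeCycle c

  prefix-closed : Factorial S → ∀ x {y} → S (x ++ y) → S x
  prefix-closed fac x {y} = fac [] x y

  suffix-closed : Factorial S → ∀ x {y} → S (x ++ y) → S y
  suffix-closed {S} fac x {y} s = fac x y [] (subst S (cong (x ++_) (sym (++-identityʳ y))) s)

  adjacent-sym : Adjacent S w v v′ → Adjacent S w v′ v
  adjacent-sym (left-right s) = right-left s
  adjacent-sym (right-left s) = left-right s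

  adjacent⇒word : Factorial S → Adjacent S w v v′ → S w
  adjacent⇒word fac (left-right {l} {r} s) = fac l _ r s
  adjacent⇒word fac (right-left {l} {r} s) = fac l _ r s

  -- Cycles whose labels are letters

  data Letter : Vertex → Set where
    left  : ∀ b → Letter (inj₁ [ b ])
    right : ∀ b → Letter (inj₂ [ b ])

  letter : label v ≢ [] → ¬ Long v → Letter v
  letter {inj₁ []}          ≢[] _    = ⊥-elim (≢[] refl)
  letter {inj₁ (b ∷ [])}    _   _    = left b
  letter {inj₁ (_ ∷ _ ∷ _)} _   long = ⊥-elim (long (s≤s (s≤s z≤n)))
  letter {inj₂ []}          ≢[] _    = ⊥-elim (≢[] refl)
  letter {inj₂ (b ∷ [])}    _   _    = right b
  letter {inj₂ (_ ∷ _ ∷ _)} _   long = ⊥-elim (long (s≤s (s≤s z≤n)))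

  module _ (a₀ : A) where

    -- a₀ is a junk value for the first letter of the empty word
    initial : Vertex → A ⊎ A
    initial = Sum.map (fromMaybe a₀ ∘ head) (fromMaybe a₀ ∘ head)

    initial-injective : Letter v → Letter v′ → initial v ≡ initial v′ → v ≡ v′
    initial-injective (left _)  (left _)  refl = refl
    initial-injective (right _) (right _) refl = refl
    initial-injective (left _)  (right _) ()
    initial-injective (right _) (left _)  ()

    initial-adjacent : Letter v → Letter v′ → Adjacent S w v v′ →
                       Graph.Edge (extGraph S w) (initial v) (initial v′)
    initial-adjacent (left _)  (right _) (left-right s) = s
    initial-adjacent (right _) (left _)  (right-left s) = s

    initial-vertex : Factorial S → Letter v → Adjacent S w v v′ →
                     Graph.Vert (extGraph S w) (initial v)
    initial-vertex {w = w} fac (left b)  (left-right s)     = prefix-closed fac (b ∷ w) s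
    initial-vertex         fac (right _) (right-left {l} s) = suffix-closed fac l s

    no-letter-code-cycle : AcyclicSet S → CodeCycle S w xs → All (∁ Long) xs → ⊥
    no-letter-code-cycle {S} {w} {x₀ ∷ xs} ((fac , _) , acyclic) c short =
      acyclic w (adjacent⇒word fac (proj₂ (All.head successors))) cycle
      where
      open CodeCycle c
      letters : All Letter (x₀ ∷ xs)
      letters = All.zipWith (λ (≢[] , ¬long) → letter ≢[] ¬long)
                            (All.tabulate (Coded.nonempty coded) , short)
      successors : All (λ x → ∃ (Adjacent S w x)) (x₀ ∷ xs)
      successors = walk-successors (x₀ ∷ xs) closed
      cycle : Cycle (extGraph S w)
      cycle = initial x₀ , map initial xs
            , subst (2 ≤_) (sym (length-map initial xs)) (≤-pred length≥3)
            , Unique-map⁺-on initial initial-injective letters unique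
            , All.map⁺ (All.zipWith (λ (l , _ , e) → initial-vertex fac l e) (letters , successors))
            , closed-map initial initial-adjacent letters closed

  data Headed (a : A) : Vertex → Set where
    headed : ∀ t → Headed a (inj₂ (a ∷ t))

  headed? : ∀ a → Decidable (Headed a)
  headed? a (inj₁ _)       = no λ ()
  headed? a (inj₂ [])      = no λ ()
  headed? a (inj₂ (b ∷ t)) with b ≟ a
  ... | yes refl = yes (headed t)
  ... | no  b≢a  = no λ { (headed _) → b≢a refl }

  Other : A → Vertex → Set
  Other a (inj₁ _) = ⊥
  Other a (inj₂ r) = ¬ Headed a (inj₂ r)

  other⇒¬headed : Other a v → ¬ Headed a v
  other⇒¬headed other h@(headed _) = other h

  data Strippable (a : A) : Vertex → Set where
    left  : ∀ l → Strippable a (inj₁ l)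
    right : ∀ t → Strippable a (inj₂ (a ∷ t))

  strippable-or-other : ∀ a v → Strippable a v ⊎ Other a v
  strippable-or-other a (inj₁ l) = inj₁ (left l)
  strippable-or-other a (inj₂ r) with headed? a (inj₂ r)
  ... | yes (headed t) = inj₁ (right t)
  ... | no  ¬headed    = inj₂ ¬headed

  excludes-letter : Coded xs → inj₂ (a ∷ b ∷ u) ∈ xs → inj₂ [ a ] ∉ xs
  excludes-letter {b = b} {u} coded long∈ a∈ = Coded.prefix-free coded a∈ long∈ (b , u , refl)

  headed-long : Coded xs → inj₂ (a ∷ b ∷ u) ∈ xs → v ∈ xs → Headed a v → Long v
  headed-long coded long∈ v∈ (headed [])      = ⊥-elim (excludes-letter coded long∈ v∈)
  headed-long coded long∈ v∈ (headed (_ ∷ _)) = s≤s (s≤s z≤n)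

  -- Shortcutting an arc through the vertex a

  adjacent-head : Factorial S → Headed a v → Adjacent S w v′ v → Adjacent S w v′ (inj₂ [ a ])
  adjacent-head {S} {a} {w = w} fac (headed t) (left-right {l} s) =
    left-right (prefix-closed fac (l ++ w ++ [ a ]) (subst S split s))
    where
    split : l ++ w ++ a ∷ t ≡ (l ++ w ++ [ a ]) ++ t
    split = sym (trans (++-assoc l (w ∷ʳ a) t) (cong (l ++_) (∷ʳ-++ w a t)))

  coded-∷-letter : Coded zs → All (∁ (Headed a)) zs → Coded (inj₂ [ a ] ∷ zs)
  coded-∷-letter {zs} {a} coded ¬headed = record
    { nonempty    = λ { (here refl) () ; (there v∈) → nonempty v∈ }
    ; prefix-free = prefix-free′
    ; suffix-free = λ { (here ()) ; (there _) (here ())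
                      ; (there l∈) (there l′∈) → suffix-free l∈ l′∈ } }
    where
    open Coded coded
    prefix-free′ : ∀ {r r′} → inj₂ r ∈ inj₂ [ a ] ∷ zs → inj₂ r′ ∈ inj₂ [ a ] ∷ zs →
                   ¬ ProperPrefix r r′
    prefix-free′             (here refl) (here refl) (_ , _ , ())
    prefix-free′             (here refl) (there r′∈) (_ , _ , refl) = All.lookup ¬headed r′∈ (headed _)
    prefix-free′ {[]}        (there r∈)  (here refl) _              = nonempty r∈ refl
    prefix-free′ {_ ∷ []}    (there _)   (here refl) (_ , _ , ())
    prefix-free′ {_ ∷ _ ∷ _} (there _)   (here refl) (_ , _ , ())
    prefix-free′             (there r∈)  (there r′∈)                = prefix-free r∈ r′∈

  -- two right vertices are never adjacent
  arc-length : Walk (Adjacent S w) (inj₂ r ∷ zs ++ [ y ]) → Any (Other a) zs → 2 ≤ length zs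
  arc-length {zs = inj₁ _ ∷ _ ∷ _} _      _          = s≤s (s≤s z≤n)
  arc-length {zs = inj₁ _ ∷ []}    _      (here ())
  arc-length {zs = inj₁ _ ∷ []}    _      (there ())
  arc-length {zs = inj₂ _ ∷ _}     (() , _) _

  weight-shortcut : ∀ T zs more → T ++ [ p ] ≡ zs ++ y ∷ more → Long y →
                    suc (weight zs) < weight (p ∷ T)
  weight-shortcut {p} {y} T zs more eq long = begin-strict
    suc (weight zs)                 <⟨ n<1+n _ ⟩
    2 + weight zs                   ≤⟨ +-monoˡ-≤ (weight zs) long ⟩
    length (label y) + weight zs    ≤⟨ +-monoˡ-≤ (weight zs) (m≤m+n _ (weight more)) ⟩
    weight (y ∷ more) + weight zs   ≡⟨ +-comm (weight (y ∷ more)) (weight zs) ⟩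
    weight zs + weight (y ∷ more)   ≡⟨ weight-++ zs (y ∷ more) ⟨
    weight (zs ++ y ∷ more)         ≡⟨ cong weight eq ⟨
    weight (T ++ [ p ])             ≡⟨ weight-↭ (∷↭∷ʳ p T) ⟨
    weight (p ∷ T)                  ∎
    where open ≤-Reasoning

  shortcut-arc : Factorial S → CodeCycle S w (p ∷ T) → inj₂ (a ∷ b ∷ u) ∈ p ∷ T →
                 Headed a p → Headed a y → T ++ [ p ] ≡ zs ++ y ∷ more →
                 All (∁ (Headed a)) zs → Any (Other a) zs → CodeCycleBelow S (weight (p ∷ T))
  shortcut-arc {S} {w} {p} {T} {a} {y = y} {zs} {more}
               fac c long∈ (headed t) hy eq ¬headed others =
    w , inj₂ [ a ] ∷ zs , cycle , weight-shortcut T zs more eq (headed-long coded long∈ y∈ hy)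
    where
    open CodeCycle c
    arc⊆ : zs ++ y ∷ more ⊆ p ∷ T
    arc⊆ = ∈-resp-↭ (↭-sym (∷↭∷ʳ p T)) ∘ subst (_ ∈_) (sym eq)
    y∈ : y ∈ p ∷ T
    y∈ = arc⊆ (∈-++⁺ʳ zs (here refl))
    arc : Walk (Adjacent S w) (p ∷ zs ++ [ y ])
    arc = walk-++⁻ˡ (p ∷ zs ++ [ y ])
            (subst (λ xs → Walk (Adjacent S w) (p ∷ xs))
                   (trans eq (sym (++-assoc zs [ y ] more))) closed)
    out-of-a : ∀ {z} → Adjacent S w p z → Adjacent S w (inj₂ [ a ]) z
    out-of-a = adjacent-sym ∘ adjacent-head fac (headed t) ∘ adjacent-sym
    into-a : ∀ {z} → Adjacent S w z y → Adjacent S w z (inj₂ [ a ])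
    into-a = adjacent-head fac hy
    cycle : CodeCycle S w (inj₂ [ a ] ∷ zs)
    cycle = record
      { length≥3 = s≤s (arc-length arc others)
      ; unique   = All.map (λ ¬h a≡ → ¬h (subst (Headed a) a≡ (headed []))) ¬headed
                   ∷ Unique-++⁻ˡ zs (subst Unique eq (CodeCycle.unique (cycle-rotate [ p ] T c)))
      ; closed   = walk-replace-ends zs out-of-a into-a arc
      ; coded    = coded-∷-letter (coded-⊆ (arc⊆ ∘ ∈-++⁺ˡ) coded) ¬headed }

  headed-in-tail : Other a n → inj₂ (a ∷ b ∷ u) ∈ n ∷ T → Any (Headed a) T
  headed-in-tail other (here refl)   = ⊥-elim (other (headed _))
  headed-in-tail other (there long∈) = Any.map (λ eq → subst (Headed _) eq (headed _)) long∈

  shortcut-from : Factorial S → CodeCycle S w (n ∷ T) → Other a n →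
                  inj₂ (a ∷ b ∷ u) ∈ n ∷ T →
                  CodeCycleBelow S (weight (n ∷ T))
  shortcut-from {n = n} {a = a} fac c other long∈
    with last-occurrence (headed? a) (headed-in-tail other long∈)
  ... | as , p , ms , refl , hp , ¬hms with first-occurrence (headed? a) (Any.++⁺ʳ as (here hp))
  ...   | zs , y , more , eq , ¬hzs , hy =
    subst (CodeCycleBelow _) (weight-↭ (++-comm (p ∷ ms) (n ∷ as)))
      (shortcut-arc fac (cycle-rotate (n ∷ as) (p ∷ ms) c)
                    (∈-resp-↭ (++-comm (n ∷ as) (p ∷ ms)) long∈)
                    hp hy arc-eq (All.++⁺ ¬hms (other⇒¬headed other ∷ ¬hzs))
                    (Any.++⁺ʳ ms (here other)))
    where
    arc-eq : (ms ++ n ∷ as) ++ [ p ] ≡ (ms ++ n ∷ zs) ++ y ∷ more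
    arc-eq = begin
      (ms ++ n ∷ as) ++ [ p ]      ≡⟨ ++-assoc ms (n ∷ as) [ p ] ⟩
      ms ++ n ∷ (as ++ [ p ])      ≡⟨ cong (λ xs → ms ++ n ∷ xs) eq ⟩
      ms ++ n ∷ (zs ++ y ∷ more)   ≡⟨ ++-assoc ms (n ∷ zs) (y ∷ more) ⟨
      (ms ++ n ∷ zs) ++ y ∷ more   ∎
      where open ≡-Reasoning

  shortcut : Factorial S → CodeCycle S w xs → inj₂ (a ∷ b ∷ u) ∈ xs → Any (Other a) xs →
             CodeCycleBelow S (weight xs)
  shortcut fac c long∈ others with find others
  ... | n , n∈ , other with ∈-∃++ n∈
  ...   | as , bs , refl =
    subst (CodeCycleBelow _) (weight-↭ (++-comm (n ∷ bs) as))
      (shortcut-from fac (cycle-rotate as (n ∷ bs) c) other (∈-resp-↭ (++-comm as (n ∷ bs)) long∈))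

  -- Stripping the first letter a from all right labels

  strip : Vertex → Vertex
  strip = Sum.map₂ (drop 1)

  strip-injective : Strippable a v → Strippable a v′ → strip v ≡ strip v′ → v ≡ v′
  strip-injective (left _)  (left _)  refl = refl
  strip-injective (right _) (right _) refl = refl
  strip-injective (left _)  (right _) ()
  strip-injective (right _) (left _)  ()

  strip-adjacent : Strippable a v → Strippable a v′ → Adjacent S w v v′ →
                   Adjacent S (w ++ [ a ]) (strip v) (strip v′)
  strip-adjacent {S = S} {w = w} (left l) (right t) (left-right s) =
    left-right (subst S (cong (l ++_) (sym (∷ʳ-++ w _ t))) s)
  strip-adjacent {S = S} {w = w} (right t) (left l) (right-left s) =
    right-left (subst S (cong (l ++_) (sym (∷ʳ-++ w _ t))) s)

  strip⁻¹-left : All (Strippable a) xs → inj₁ l ∈ map strip xs → inj₁ l ∈ xs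
  strip⁻¹-left (left _ ∷ _)  (here refl) = here refl
  strip⁻¹-left (right _ ∷ _) (here ())
  strip⁻¹-left (_ ∷ ss)      (there l∈)  = there (strip⁻¹-left ss l∈)

  strip⁻¹-right : All (Strippable a) xs → inj₂ r ∈ map strip xs → inj₂ (a ∷ r) ∈ xs
  strip⁻¹-right (right _ ∷ _) (here refl) = here refl
  strip⁻¹-right (left _ ∷ _)  (here ())
  strip⁻¹-right (_ ∷ ss)      (there r∈)  = there (strip⁻¹-right ss r∈)

  coded-strip : Coded xs → All (Strippable a) xs → inj₂ (a ∷ b ∷ u) ∈ xs → Coded (map strip xs)
  coded-strip {xs} coded ss long∈ = record
    { nonempty    = nonempty′
    ; prefix-free = λ r∈ r′∈ (c , z , eq) →
        prefix-free (strip⁻¹-right ss r∈) (strip⁻¹-right ss r′∈) (c , z , cong (_ ∷_) eq)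
    ; suffix-free = λ l∈ l′∈ → suffix-free (strip⁻¹-left ss l∈) (strip⁻¹-left ss l′∈) }
    where
    open Coded coded
    nonempty′ : ∀ {v} → v ∈ map strip xs → label v ≢ []
    nonempty′ {inj₁ _} l∈      = nonempty (strip⁻¹-left ss l∈)
    nonempty′ {inj₂ _} r∈ refl = excludes-letter coded long∈ (strip⁻¹-right ss r∈)

  label-strip-≤ : ∀ v → length (label (strip v)) ≤ length (label v)
  label-strip-≤ (inj₁ _)       = ≤-refl
  label-strip-≤ (inj₂ [])      = ≤-refl
  label-strip-≤ (inj₂ (_ ∷ r)) = n≤1+n (length r)

  weight-strip-≤ : ∀ xs → weight (map strip xs) ≤ weight xs
  weight-strip-≤ []       = z≤n
  weight-strip-≤ (v ∷ xs) = +-mono-≤ (label-strip-≤ v) (weight-strip-≤ xs)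

  weight-strip-< : inj₂ (b ∷ r) ∈ xs → weight (map strip xs) < weight xs
  weight-strip-< {xs = _ ∷ xs} (here refl) = +-mono-<-≤ ≤-refl (weight-strip-≤ xs)
  weight-strip-< {xs = v ∷ _}  (there r∈)  = +-mono-≤-< (label-strip-≤ v) (weight-strip-< r∈)

  strip-cycle : CodeCycle S w xs → All (Strippable a) xs → inj₂ (a ∷ b ∷ u) ∈ xs →
                CodeCycle S (w ++ [ a ]) (map strip xs)
  strip-cycle {xs = xs} c ss long∈ = record
    { length≥3 = subst (3 ≤_) (sym (length-map strip xs)) length≥3
    ; unique   = Unique-map⁺-on strip strip-injective ss unique
    ; closed   = closed-map strip strip-adjacent ss closed
    ; coded    = coded-strip coded ss long∈ }
    where open CodeCycle c

  shorten-right : Factorial S → CodeCycle S w xs → inj₂ r ∈ xs → 2 ≤ length r →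
                  CodeCycleBelow S (weight xs)
  shorten-right {xs = xs} {r = a ∷ _ ∷ _} fac c long∈ _ with First.first (strippable-or-other a) xs
  ... | inj₁ others     = shortcut fac c long∈ (First.toAny others)
  ... | inj₂ strippable = _ , _ , strip-cycle c strippable long∈ , weight-strip-< long∈
  shorten-right {r = _ ∷ []} _ _ _ (s≤s ())

  -- Reversing all words

  mirror : Vertex → Vertex
  mirror (inj₁ l) = inj₂ (reverse l)
  mirror (inj₂ r) = inj₁ (reverse r)

  Reversed : (Word → Set) → Word → Set
  Reversed S x = S (reverse x)

  reverse-++₃ : ∀ (x y z : Word) → reverse (x ++ y ++ z) ≡ reverse z ++ reverse y ++ reverse x
  reverse-++₃ x y z = begin
    reverse (x ++ y ++ z)                   ≡⟨ reverse-++ x (y ++ z) ⟩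
    reverse (y ++ z) ++ reverse x           ≡⟨ cong (_++ reverse x) (reverse-++ y z) ⟩
    (reverse z ++ reverse y) ++ reverse x   ≡⟨ ++-assoc (reverse z) (reverse y) (reverse x) ⟩
    reverse z ++ reverse y ++ reverse x     ∎
    where open ≡-Reasoning

  reverse-≢-[] : ∀ {x : Word} → x ≢ [] → reverse x ≢ []
  reverse-≢-[] x≢[] = x≢[] ∘ reverse-injective

  proper-prefix : ∀ {x y} z → z ≢ [] → y ≡ x ++ z → ProperPrefix x y
  proper-prefix []      z≢[] _  = ⊥-elim (z≢[] refl)
  proper-prefix (c ∷ z) _    eq = c , z , eq

  proper-suffix : ∀ {x y} z → z ≢ [] → y ≡ z ++ x → ProperSuffix x y
  proper-suffix []      z≢[] _  = ⊥-elim (z≢[] refl)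
  proper-suffix (c ∷ z) _    eq = c , z , eq

  reverse-properPrefix : ∀ {x y} → ProperPrefix (reverse x) (reverse y) → ProperSuffix x y
  reverse-properPrefix {x} {y} (c , z , eq) =
    proper-suffix (reverse (c ∷ z)) (reverse-≢-[] {c ∷ z} λ ()) (begin
    y                                        ≡⟨ reverse-involutive y ⟨
    reverse (reverse y)                      ≡⟨ cong reverse eq ⟩
    reverse (reverse x ++ c ∷ z)             ≡⟨ reverse-++ (reverse x) (c ∷ z) ⟩
    reverse (c ∷ z) ++ reverse (reverse x)   ≡⟨ cong (reverse (c ∷ z) ++_) (reverse-involutive x) ⟩
    reverse (c ∷ z) ++ x                     ∎)
    where open ≡-Reasoning

  reverse-properSuffix : ∀ {x y} → ProperSuffix (reverse x) (reverse y) → ProperPrefix x y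
  reverse-properSuffix {x} {y} (c , z , eq) =
    proper-prefix (reverse (c ∷ z)) (reverse-≢-[] {c ∷ z} λ ()) (begin
    y                                        ≡⟨ reverse-involutive y ⟨
    reverse (reverse y)                      ≡⟨ cong reverse eq ⟩
    reverse ((c ∷ z) ++ reverse x)           ≡⟨ reverse-++ (c ∷ z) (reverse x) ⟩
    reverse (reverse x) ++ reverse (c ∷ z)   ≡⟨ cong (_++ reverse (c ∷ z)) (reverse-involutive x) ⟩
    x ++ reverse (c ∷ z)                     ∎)
    where open ≡-Reasoning

  factorial-reversed : Factorial S → Factorial (Reversed S)
  factorial-reversed {S} fac u v x s =
    fac (reverse x) (reverse v) (reverse u) (subst S (reverse-++₃ u v x) s)

  mirror-injective : mirror v ≡ mirror v′ → v ≡ v′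
  mirror-injective {inj₁ _} {inj₁ _} eq = cong inj₁ (reverse-injective (inj₂-injective eq))
  mirror-injective {inj₂ _} {inj₂ _} eq = cong inj₂ (reverse-injective (inj₁-injective eq))
  mirror-injective {inj₁ _} {inj₂ _} ()
  mirror-injective {inj₂ _} {inj₁ _} ()

  mirror-adjacent : (∀ {x} → S x → S′ (reverse x)) → Adjacent S w v v′ →
                    Adjacent S′ (reverse w) (mirror v) (mirror v′)
  mirror-adjacent {S′ = S′} {w} rev (left-right {l} {r} s) =
    right-left (subst S′ (reverse-++₃ l w r) (rev s))
  mirror-adjacent {S′ = S′} {w} rev (right-left {l} {r} s) =
    left-right (subst S′ (reverse-++₃ l w r) (rev s))

  mirror⁻¹-left : inj₁ l ∈ map mirror xs → Σ Word λ r → inj₂ r ∈ xs × l ≡ reverse r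
  mirror⁻¹-left {xs = inj₂ r ∷ _} (here refl) = r , here refl , refl
  mirror⁻¹-left {xs = inj₁ _ ∷ _} (here ())
  mirror⁻¹-left {xs = _ ∷ _}      (there l∈) with mirror⁻¹-left l∈
  ... | r , r∈ , eq = r , there r∈ , eq

  mirror⁻¹-right : inj₂ r ∈ map mirror xs → Σ Word λ l → inj₁ l ∈ xs × r ≡ reverse l
  mirror⁻¹-right {xs = inj₁ l ∷ _} (here refl) = l , here refl , refl
  mirror⁻¹-right {xs = inj₂ _ ∷ _} (here ())
  mirror⁻¹-right {xs = _ ∷ _}      (there r∈) with mirror⁻¹-right r∈
  ... | l , l∈ , eq = l , there l∈ , eq

  coded-mirror : Coded xs → Coded (map mirror xs)
  coded-mirror {xs} coded =
    record { nonempty = nonempty′ ; prefix-free = prefix-free′ ; suffix-free = suffix-free′ }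
    where
    open Coded coded
    nonempty′ : ∀ {v} → v ∈ map mirror xs → label v ≢ []
    nonempty′ {inj₁ _} l∈ with mirror⁻¹-left l∈
    ... | _ , r∈ , refl = reverse-≢-[] (nonempty r∈)
    nonempty′ {inj₂ _} r∈ with mirror⁻¹-right r∈
    ... | _ , l∈ , refl = reverse-≢-[] (nonempty l∈)
    prefix-free′ : ∀ {r r′} → inj₂ r ∈ map mirror xs → inj₂ r′ ∈ map mirror xs →
                   ¬ ProperPrefix r r′
    prefix-free′ r∈ r′∈ with mirror⁻¹-right r∈ | mirror⁻¹-right r′∈
    ... | _ , l∈ , refl | _ , l′∈ , refl = suffix-free l∈ l′∈ ∘ reverse-properPrefix
    suffix-free′ : ∀ {l l′} → inj₁ l ∈ map mirror xs → inj₁ l′ ∈ map mirror xs →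
                   ¬ ProperSuffix l l′
    suffix-free′ l∈ l′∈ with mirror⁻¹-left l∈ | mirror⁻¹-left l′∈
    ... | _ , r∈ , refl | _ , r′∈ , refl = prefix-free r∈ r′∈ ∘ reverse-properSuffix

  weight-mirror : ∀ xs → weight (map mirror xs) ≡ weight xs
  weight-mirror []            = refl
  weight-mirror (inj₁ l ∷ xs) = cong₂ _+_ (length-reverse l) (weight-mirror xs)
  weight-mirror (inj₂ r ∷ xs) = cong₂ _+_ (length-reverse r) (weight-mirror xs)

  cycle-mirror : (∀ {x} → S x → S′ (reverse x)) → CodeCycle S w xs →
                 CodeCycle S′ (reverse w) (map mirror xs)
  cycle-mirror {xs = xs} rev c = record
    { length≥3 = subst (3 ≤_) (sym (length-map mirror xs)) length≥3
    ; unique   = Unique.map⁺ mirror-injective unique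
    ; closed   = closed-map mirror (λ _ _ → mirror-adjacent rev) (All.universal (λ _ → tt) xs) closed
    ; coded    = coded-mirror coded }
    where open CodeCycle c

  shorten-left : Factorial S → CodeCycle S w xs → inj₁ l ∈ xs → 2 ≤ length l →
                 CodeCycleBelow S (weight xs)
  shorten-left {S} {xs = xs} {l} fac c l∈ long
    with shorten-right (factorial-reversed fac) (cycle-mirror (subst S (sym (reverse-involutive _))) c)
                       (∈-map⁺ mirror l∈) (subst (2 ≤_) (sym (length-reverse l)) long)
  ... | w′ , ys , c′ , lighter =
    reverse w′ , map mirror ys , cycle-mirror id c′ ,
    subst₂ _<_ (sym (weight-mirror ys)) (weight-mirror xs) lighter

  shorten : Factorial S → CodeCycle S w xs → Any Long xs → CodeCycleBelow S (weight xs)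
  shorten fac c longs with find longs
  ... | inj₁ l , l∈ , long = shorten-left  fac c l∈ long
  ... | inj₂ r , r∈ , long = shorten-right fac c r∈ long

  no-code-cycle : A → AcyclicSet S → Acc _<_ (weight xs) → ¬ CodeCycle S w xs
  no-code-cycle {xs = xs} a₀ acyclic (acc lighter) c with Any.any? long? xs
  ... | no ¬longs = no-letter-code-cycle a₀ acyclic c (All.¬Any⇒All¬ xs ¬longs)
  ... | yes longs with shorten (proj₁ (proj₁ acyclic)) c longs
  ...   | _ , _ , c′ , lt = no-code-cycle a₀ acyclic (lighter lt) c′

  code-cycle : ∀ {U V} → SuffixCode U → PrefixCode V → Cycle (genExtGraph S U V w) →
               Σ (List Vertex) (CodeCycle S w)
  code-cycle {S} {w} {U} {V} (U≢[] , U-suffix) (V≢[] , V-prefix)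
             (v , vs , 2≤ , uniq , vertices , walk) =
    v ∷ vs , record
    { length≥3 = s≤s 2≤
    ; unique   = uniq
    ; closed   = walk-weaken adjacent walk
    ; coded    = record
      { nonempty    = λ { {inj₁ l} l∈ → U≢[] l (member l∈)
                        ; {inj₂ r} r∈ → V≢[] r (member r∈) }
      ; prefix-free = λ r∈ r′∈ → V-prefix _ _ (member r∈) (member r′∈)
      ; suffix-free = λ l∈ l′∈ → U-suffix _ _ (member l∈) (member l′∈) } }
    where
    member : ∀ {x} → x ∈ v ∷ vs → label x ∈ Sum.[ (λ _ → U) , (λ _ → V) ]′ x
    member {inj₁ _} x∈ = proj₁ (All.lookup vertices x∈)
    member {inj₂ _} x∈ = proj₁ (All.lookup vertices x∈)
    adjacent : ∀ {x y} → Graph.Edge (genExtGraph S U V w) x y → Adjacent S w x y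
    adjacent {inj₁ _} {inj₂ _} (_ , _ , s) = left-right s
    adjacent {inj₂ _} {inj₁ _} (_ , _ , s) = right-left s

proposition3p7 : (k : ℕ) → let open Words (Fin (suc k)) in
    (S : Word → Set) → AcyclicSet S →
    (w : Word) → S w →
    (U V : List Word) → SuffixCode U → PrefixCode V →
    Acyclic (genExtGraph S U V w)
proposition3p7 k S acyclic w _ U V suffix prefix cycle =
  let xs , c = code-cycle suffix prefix cycle in
  no-code-cycle Fin.zero acyclic (<-wellFounded (weight xs)) c
  where open CodeCycles (Fin (suc k)) Fin._≟_
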